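{- Let $G$ be a connected graph with at least $2$ vertices and $H$ a connected graph. Then \[F(G+_R H)=8|V(H)|F(G)+|V(G)|F(H)+24|E(H)|M_1(G)+12|E(G)|M_1(H)+8|V(H)||E(G)|.\]
   Context: All graphs are finite, simple and undirected; $d_G(v)$ denotes degree. $F(G)=\sum_{v\in V(G)}d_G(v)^3$ and $M_1(G)=\sum_{v\in V(G)}d_G(v)^2$. The triangle parallel graph $R(G)$ has vertex set $V(G)\cup E(G)$ and is obtained from $G$ by replacing each edge by a triangle: for each edge $e=uv$ the vertex $e$ is adjacent to $u$ and $v$, and the edge $uv$ is kept. The $R$-sum $G+_R H$ is the graph with vertex set $(V(G)\cup E(G))\times V(H)$ in which $(u,v)$ and $(u',v')$ are adjacent if and only if [$u=u'\in V(G)$ and $vv'\in E(H)$] or [$v=v'$ and $uu'\in E(R(G))$]. -}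

module Defs where

open import Data.Nat using (ℕ; zero; suc; _+_; _*_; _^_; _<ᵇ_)
open import Data.Bool using (Bool; true; false; if_then_else_; _∧_; _∨_; T)
open import Data.Fin using (Fin; zero; suc; toℕ; splitAt; remQuot)
open import Data.Fin.Properties using (_≟_)
open import Data.List using (List; length; lookup; filterᵇ; concatMap; map; allFin)
open import Data.Product using (_×_; _,_)
open import Data.Sum using (_⊎_; inj₁; inj₂)
open import Relation.Nullary.Decidable using (⌊_⌋)
open import Relation.Binary.PropositionalEquality using (_≡_)
open import Relation.Binary.Construct.Closure.ReflexiveTransitive using (Star)

record SimpleGraph : Set where
  field
    n      : ℕ
    adj    : Fin n → Fin n → Bool
    sym    : ∀ i j → adj i j ≡ adj j i
    irrefl : ∀ i → adj i i ≡ false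
open SimpleGraph public

σ : ∀ {n} → (Fin n → ℕ) → ℕ
σ {zero}  f = 0
σ {suc n} f = f zero + σ (λ i → f (suc i))

degA : ∀ {n} → (Fin n → Fin n → Bool) → Fin n → ℕ
degA a i = σ (λ j → if a i j then 1 else 0)

FA : ∀ {n} → (Fin n → Fin n → Bool) → ℕ
FA a = σ (λ i → degA a i ^ 3)

M1A : ∀ {n} → (Fin n → Fin n → Bool) → ℕ
M1A a = σ (λ i → degA a i ^ 2)

edges : (G : SimpleGraph) → List (Fin (n G) × Fin (n G))
edges G = concatMap (λ i → map (λ j → (i , j))
            (filterᵇ (λ j → (toℕ i <ᵇ toℕ j) ∧ adj G i j) (allFin (n G))))
          (allFin (n G))

∣V∣ : SimpleGraph → ℕ
∣V∣ G = n G

∣E∣ : SimpleGraph → ℕ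
∣E∣ G = length (edges G)

F : SimpleGraph → ℕ
F G = FA (adj G)

M₁ : SimpleGraph → ℕ
M₁ G = M1A (adj G)

endpoints : (G : SimpleGraph) → Fin (∣E∣ G) → Fin (n G) × Fin (n G)
endpoints G k = lookup (edges G) k

_==_ : ∀ {m} → Fin m → Fin m → Bool
x == y = ⌊ x ≟ y ⌋

-- Triangle parallel graph R(G): vertex set V(G) ⊎ E(G), encoded as
-- Fin (|V(G)| + |E(G)|) (first block = vertices, second block = edges).
RAdj' : (G : SimpleGraph) → Fin (n G) ⊎ Fin (∣E∣ G) → Fin (n G) ⊎ Fin (∣E∣ G) → Bool
RAdj' G (inj₁ u) (inj₁ u') = adj G u u'
RAdj' G (inj₁ u) (inj₂ e) with endpoints G e
... | (a , b) = (u == a) ∨ (u == b)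
RAdj' G (inj₂ e) (inj₁ u) with endpoints G e
... | (a , b) = (u == a) ∨ (u == b)
RAdj' G (inj₂ e) (inj₂ e') = false

RAdj : (G : SimpleGraph) → Fin (n G + ∣E∣ G) → Fin (n G + ∣E∣ G) → Bool
RAdj G x y = RAdj' G (splitAt (n G) x) (splitAt (n G) y)

isVertex : (G : SimpleGraph) → Fin (n G + ∣E∣ G) → Bool
isVertex G x with splitAt (n G) x
... | inj₁ _ = true
... | inj₂ _ = false

-- R-sum G +_R H: vertex set (V(G) ∪ E(G)) × V(H), encoded as
-- Fin ((|V(G)| + |E(G)|) * |V(H)|) via remQuot.
RSumN : SimpleGraph → SimpleGraph → ℕ
RSumN G H = (n G + ∣E∣ G) * n H

RSumAdj : (G H : SimpleGraph) → Fin (RSumN G H) → Fin (RSumN G H) → Bool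
RSumAdj G H p q with remQuot (n H) p | remQuot (n H) q
... | (x , v) | (x' , v') =
  (isVertex G x ∧ (x == x') ∧ adj H v v') ∨ ((v == v') ∧ RAdj G x x')

FRSum : SimpleGraph → SimpleGraph → ℕ
FRSum G H = FA (RSumAdj G H)

Connected : SimpleGraph → Set
Connected G = ∀ (u v : Fin (n G)) → Star (λ i j → T (adj G i j)) u v

-- A vertex (x , v) of G +_R H has degree d_H(v) + d_{R(G)}(x) when x ∈ V(G) and
-- d_{R(G)}(x) when x ∈ E(G), where d_{R(G)}(u) = 2 d_G(u) and every edge-vertex of
-- R(G) has degree 2.  Summing (2 d_G(u) + d_H(v))³ over V(G) × V(H) separates by
-- the binomial theorem into products of degree power sums, i.e. F, M₁ and (by the
-- handshake lemma) |E|, while the edge-vertices contribute 2³ |E(G)| |V(H)|.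
module Submission where

open import Defs hiding (sym)
open import Data.Nat using (ℕ; zero; suc; _+_; _*_; _^_; _≤_; _<ᵇ_)
open import Data.Nat.Properties
  using ( +-commutativeSemigroup; +-identityʳ; *-identityʳ; +-comm; +-assoc; *-zeroʳ; *-comm
        ; *-distribˡ-+; <ᵇ⇒<; <ᵇ-reflects-<; <-asym; ≮⇒≥; ≤-antisym)
open import Data.Nat.ListAction using (sum)
open import Data.Nat.ListAction.Properties using (sum-++)
open import Data.Nat.Tactic.RingSolver using (solve-∀)
open import Data.Nat.Solver using (module +-*-Solver)
open import Algebra.Properties.CommutativeSemigroup +-commutativeSemigroup
  renaming (interchange to +-interchange)
open import Data.Bool using (Bool; true; false; if_then_else_; _∧_; _∨_; T)
open import Data.Bool.Properties using (T-∧)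
open import Data.Fin using (Fin; zero; suc; toℕ; _↑ˡ_; _↑ʳ_; join; splitAt; combine)
open import Data.Fin.Properties
  using (_≟_; <⇒≢; toℕ-injective; splitAt-join; splitAt-↑ˡ; splitAt-↑ʳ; remQuot-combine)
open import Data.List using (List; []; _∷_; _++_; map; filterᵇ; concatMap; tabulate; lookup; allFin)
open import Data.List.Properties using (map-++; map-∘; map-cong)
open import Data.List.Relation.Unary.All as All using (All)
open import Data.List.Relation.Unary.All.Properties using (concat⁺; map⁺; all-filter)
open import Data.List.Membership.Propositional.Properties using (∈-lookup)
open import Data.Product using (_×_; _,_; proj₁; proj₂)
open import Data.Sum using (_⊎_; inj₁; inj₂)
open import Data.Empty using (⊥-elim)
open import Function using (_∘_; id; Equivalence)
open import Relation.Nullary using (yes; no)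
open import Relation.Nullary.Decidable using (toWitness; T?)
open import Relation.Nullary.Reflects using (ofʸ; ofⁿ)
open import Relation.Binary.PropositionalEquality
  using (_≡_; _≢_; refl; sym; trans; cong; cong₂; subst; module ≡-Reasoning)

open ≡-Reasoning

ι : Bool → ℕ
ι b = if b then 1 else 0

ι-∧ : ∀ a b → ι (a ∧ b) ≡ ι a * ι b
ι-∧ false b = refl
ι-∧ true  b = sym (+-identityʳ (ι b))

==-refl : ∀ {n} (i : Fin n) → (i == i) ≡ true
==-refl i with i ≟ i
... | yes _   = refl
... | no i≢i = ⊥-elim (i≢i refl)

==-≢ : ∀ {n} {i j : Fin n} → i ≢ j → (i == j) ≡ false
==-≢ {i = i} {j} i≢j with i ≟ j
... | yes i≡j = ⊥-elim (i≢j i≡j)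
... | no _    = refl

==-sym : ∀ {n} (i j : Fin n) → (i == j) ≡ (j == i)
==-sym i j with i ≟ j
... | yes refl = sym (==-refl i)
... | no i≢j   = sym (==-≢ (i≢j ∘ sym))

==⇒≡ : ∀ {n} {i j : Fin n} → (i == j) ≡ true → i ≡ j
==⇒≡ {i = i} {j} i=j = toWitness {a? = i ≟ j} (subst T (sym i=j) _)

==-suc : ∀ {n} (i j : Fin n) → (suc i == suc j) ≡ (i == j)
==-suc i j with i ≟ j
... | yes _ = refl
... | no _  = refl

σ-cong : ∀ {n} {f g : Fin n → ℕ} → (∀ i → f i ≡ g i) → σ f ≡ σ g
σ-cong {zero}  f≗g = refl
σ-cong {suc n} f≗g = cong₂ _+_ (f≗g zero) (σ-cong (f≗g ∘ suc))

σ-const : ∀ n (c : ℕ) → σ {n} (λ _ → c) ≡ n * c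
σ-const zero    c = refl
σ-const (suc n) c = cong (c +_) (σ-const n c)

σ-zero : ∀ n → σ {n} (λ _ → 0) ≡ 0
σ-zero n = trans (σ-const n 0) (*-zeroʳ n)

σ-distrib-+ : ∀ {n} (f g : Fin n → ℕ) → σ (λ i → f i + g i) ≡ σ f + σ g
σ-distrib-+ {zero}  f g = refl
σ-distrib-+ {suc n} f g = begin
  f zero + g zero + σ (λ i → f (suc i) + g (suc i))
    ≡⟨ cong (f zero + g zero +_) (σ-distrib-+ (f ∘ suc) (g ∘ suc)) ⟩
  f zero + g zero + (σ (f ∘ suc) + σ (g ∘ suc))
    ≡⟨ +-interchange (f zero) (g zero) (σ (f ∘ suc)) (σ (g ∘ suc)) ⟩
  f zero + σ (f ∘ suc) + (g zero + σ (g ∘ suc)) ∎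

σ-*ˡ : ∀ {n} (c : ℕ) (f : Fin n → ℕ) → σ (λ i → c * f i) ≡ c * σ f
σ-*ˡ {zero}  c f = sym (*-zeroʳ c)
σ-*ˡ {suc n} c f =
  trans (cong (c * f zero +_) (σ-*ˡ c (f ∘ suc))) (sym (*-distribˡ-+ c (f zero) (σ (f ∘ suc))))

σ-*ʳ : ∀ {n} (f : Fin n → ℕ) (c : ℕ) → σ (λ i → f i * c) ≡ σ f * c
σ-*ʳ f c = trans (σ-cong (λ i → *-comm (f i) c)) (trans (σ-*ˡ c f) (*-comm c (σ f)))

σ-swap : ∀ {m n} (f : Fin m → Fin n → ℕ) → σ (λ i → σ (f i)) ≡ σ (λ j → σ (λ i → f i j))
σ-swap {zero}  {n} f = sym (σ-zero n)
σ-swap {suc m} {n} f =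
  trans (cong (σ (f zero) +_) (σ-swap (f ∘ suc))) (sym (σ-distrib-+ (f zero) (λ j → σ (λ i → f (suc i) j))))

σ-↑ : ∀ m {n} (f : Fin (m + n) → ℕ) → σ f ≡ σ (λ i → f (i ↑ˡ n)) + σ (λ j → f (m ↑ʳ j))
σ-↑ zero    f = refl
σ-↑ (suc m) f = trans (cong (f zero +_) (σ-↑ m (f ∘ suc))) (sym (+-assoc (f zero) _ _))

σ-combine : ∀ m {k} (f : Fin (m * k) → ℕ) → σ f ≡ σ (λ (x : Fin m) → σ (λ (v : Fin k) → f (combine x v)))
σ-combine zero    f = refl
σ-combine (suc m) {k} f =
  trans (σ-↑ k f) (cong (σ (λ v → f (v ↑ˡ (m * k))) +_) (σ-combine m (λ p → f (k ↑ʳ p))))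

σ-δ : ∀ {n} (i : Fin n) (f : Fin n → ℕ) → σ (λ j → ι (i == j) * f j) ≡ f i
σ-δ {suc n} zero    f = trans (cong (f zero + 0 +_) (σ-zero n)) (trans (+-identityʳ _) (+-identityʳ _))
σ-δ {suc n} (suc i) f = trans (σ-cong (λ j → cong (λ b → ι b * f (suc j)) (==-suc i j))) (σ-δ i (f ∘ suc))

σ-δ-count : ∀ {n} (i : Fin n) → σ (λ j → ι (j == i)) ≡ 1
σ-δ-count i = trans (σ-cong (λ j → trans (cong ι (==-sym j i)) (sym (*-identityʳ _)))) (σ-δ i (λ _ → 1))

σ² : ∀ {m n} → (Fin m → Fin n → ℕ) → ℕ
σ² h = σ (λ x → σ (h x))

σ²-cong : ∀ {m n} {h h' : Fin m → Fin n → ℕ} → (∀ x y → h x y ≡ h' x y) → σ² h ≡ σ² h'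
σ²-cong h≗h' = σ-cong (λ x → σ-cong (h≗h' x))

σ²-distrib-+ : ∀ {m n} (h h' : Fin m → Fin n → ℕ) → σ² (λ x y → h x y + h' x y) ≡ σ² h + σ² h'
σ²-distrib-+ h h' = trans (σ-cong (λ x → σ-distrib-+ (h x) (h' x))) (σ-distrib-+ (σ ∘ h) (σ ∘ h'))

σ²-* : ∀ {m n} (f : Fin m → ℕ) (g : Fin n → ℕ) → σ² (λ x y → f x * g y) ≡ σ f * σ g
σ²-* f g = trans (σ-cong (λ x → σ-*ˡ (f x) g)) (σ-*ʳ f (σ g))

σ²-cube-+ : ∀ {m n} (f : Fin m → ℕ) (g : Fin n → ℕ) →
  σ² (λ x y → (f x + g y) ^ 3)
    ≡ n * σ (λ x → f x ^ 3) + 3 * σ (λ x → f x ^ 2) * σ g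
      + 3 * σ f * σ (λ y → g y ^ 2) + m * σ (λ y → g y ^ 3)
σ²-cube-+ {m} {n} f g = begin
  σ² (λ x y → (f x + g y) ^ 3)
    ≡⟨ σ²-cong (λ x y → binomial (f x) (g y)) ⟩
  σ² (λ x y → t₀ x y + t₁ x y + t₂ x y + t₃ x y)
    ≡⟨ trans (σ²-distrib-+ (λ x y → t₀ x y + t₁ x y + t₂ x y) t₃)
             (cong (_+ σ² t₃) (trans (σ²-distrib-+ (λ x y → t₀ x y + t₁ x y) t₂)
                                     (cong (_+ σ² t₂) (σ²-distrib-+ t₀ t₁)))) ⟩
  σ² t₀ + σ² t₁ + σ² t₂ + σ² t₃
    ≡⟨ cong₂ _+_ (cong₂ _+_ (cong₂ _+_ (σ²-* {n = n} (λ x → f x ^ 3) (λ _ → 1))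
                                      (σ²-* (λ x → 3 * f x ^ 2) g))
                            (σ²-* (λ x → 3 * f x) (λ y → g y ^ 2)))
                 (σ²-* {m} (λ _ → 1) (λ y → g y ^ 3)) ⟩
  σ (λ x → f x ^ 3) * σ {n} (λ _ → 1) + σ (λ x → 3 * f x ^ 2) * σ g
    + σ (λ x → 3 * f x) * σ (λ y → g y ^ 2) + σ {m} (λ _ → 1) * σ (λ y → g y ^ 3)
    ≡⟨ cong₂ _+_ (cong₂ _+_ (cong₂ _+_ (trans (cong (σ (λ x → f x ^ 3) *_) (trans (σ-const n 1) (*-identityʳ n)))
                                             (*-comm (σ (λ x → f x ^ 3)) n))
                                      (cong (_* σ g) (σ-*ˡ 3 (λ x → f x ^ 2))))
                            (cong (_* σ (λ y → g y ^ 2)) (σ-*ˡ 3 f)))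
                 (cong (_* σ (λ y → g y ^ 3)) (trans (σ-const m 1) (*-identityʳ m))) ⟩
  n * σ (λ x → f x ^ 3) + 3 * σ (λ x → f x ^ 2) * σ g
    + 3 * σ f * σ (λ y → g y ^ 2) + m * σ (λ y → g y ^ 3) ∎
  where
  t₀ t₁ t₂ t₃ : Fin m → Fin n → ℕ
  t₀ x y = f x ^ 3 * 1
  t₁ x y = 3 * f x ^ 2 * g y
  t₂ x y = 3 * f x * g y ^ 2
  t₃ x y = 1 * g y ^ 3
  binomial : ∀ a b → (a + b) ^ 3 ≡ a ^ 3 * 1 + 3 * a ^ 2 * b + 3 * a * b ^ 2 + 1 * b ^ 3
  binomial = solve 2 (λ a b → (a :+ b) :^ 3 := a :^ 3 :* con 1 :+ con 3 :* a :^ 2 :* b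
                                                :+ con 3 :* a :* b :^ 2 :+ con 1 :* b :^ 3) refl
    where open +-*-Solver

module _ {A : Set} where

  σ-lookup : (xs : List A) (g : A → ℕ) → σ (g ∘ lookup xs) ≡ sum (map g xs)
  σ-lookup []       g = refl
  σ-lookup (x ∷ xs) g = cong (g x +_) (σ-lookup xs g)

  sum-map-tabulate : ∀ {n} (f : Fin n → A) (g : A → ℕ) → sum (map g (tabulate f)) ≡ σ (g ∘ f)
  sum-map-tabulate {zero}  f g = refl
  sum-map-tabulate {suc n} f g = cong (g (f zero) +_) (sum-map-tabulate (f ∘ suc) g)

  sum-map-filterᵇ : (p : A → Bool) (g : A → ℕ) (xs : List A) →
    sum (map g (filterᵇ p xs)) ≡ sum (map (λ x → ι (p x) * g x) xs)
  sum-map-filterᵇ p g []       = refl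
  sum-map-filterᵇ p g (x ∷ xs) with p x
  ... | true  = cong₂ _+_ (sym (+-identityʳ (g x))) (sum-map-filterᵇ p g xs)
  ... | false = sum-map-filterᵇ p g xs

  sum-map-concatMap : ∀ {B : Set} (f : B → List A) (g : A → ℕ) (xs : List B) →
    sum (map g (concatMap f xs)) ≡ sum (map (λ x → sum (map g (f x))) xs)
  sum-map-concatMap f g []       = refl
  sum-map-concatMap f g (x ∷ xs) = begin
    sum (map g (f x ++ concatMap f xs))
      ≡⟨ cong sum (map-++ g (f x) (concatMap f xs)) ⟩
    sum (map g (f x) ++ map g (concatMap f xs))
      ≡⟨ sum-++ (map g (f x)) (map g (concatMap f xs)) ⟩
    sum (map g (f x)) + sum (map g (concatMap f xs))
      ≡⟨ cong (sum (map g (f x)) +_) (sum-map-concatMap f g xs) ⟩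
    sum (map g (f x)) + sum (map (λ y → sum (map g (f y))) xs) ∎

deg : (G : SimpleGraph) → Fin (n G) → ℕ
deg G = degA (adj G)

ascAdj : (G : SimpleGraph) → Fin (n G) → Fin (n G) → Bool
ascAdj G i j = (toℕ i <ᵇ toℕ j) ∧ adj G i j

ascAdj⇒≢ : (G : SimpleGraph) {i j : Fin (n G)} → T (ascAdj G i j) → i ≢ j
ascAdj⇒≢ G {i} {j} asc = <⇒≢ (<ᵇ⇒< (toℕ i) (toℕ j) (proj₁ (Equivalence.to T-∧ asc)))

ascAdj-+-ascAdj : (G : SimpleGraph) (u j : Fin (n G)) → ι (ascAdj G u j) + ι (ascAdj G j u) ≡ ι (adj G u j)
ascAdj-+-ascAdj G u j rewrite SimpleGraph.sym G j u
  with toℕ u <ᵇ toℕ j | <ᵇ-reflects-< (toℕ u) (toℕ j) | toℕ j <ᵇ toℕ u | <ᵇ-reflects-< (toℕ j) (toℕ u)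
... | true  | ofʸ u<j | true  | ofʸ j<u = ⊥-elim (<-asym u<j j<u)
... | true  | _       | false | _       = +-identityʳ _
... | false | _       | true  | _       = refl
... | false | ofⁿ u≮j | false | ofⁿ j≮u with toℕ-injective {i = u} {j} (≤-antisym (≮⇒≥ j≮u) (≮⇒≥ u≮j))
...   | refl rewrite irrefl G u = refl

endpoints-ascending : (G : SimpleGraph) (e : Fin (∣E∣ G)) →
  T (ascAdj G (proj₁ (endpoints G e)) (proj₂ (endpoints G e)))
endpoints-ascending G e = All.lookup edges-ascending (∈-lookup e)
  where
  edges-ascending : All (λ p → T (ascAdj G (proj₁ p) (proj₂ p))) (edges G)
  edges-ascending = concat⁺ (map⁺ (All.universal (map⁺ ∘ row-ascending) (allFin (n G))))
    where
    row-ascending : ∀ i → All (λ j → T (ascAdj G i j)) (filterᵇ (ascAdj G i) (allFin (n G)))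
    row-ascending i = all-filter (T? ∘ ascAdj G i) (allFin (n G))

σ-edges : (G : SimpleGraph) (h : Fin (n G) × Fin (n G) → ℕ) →
  σ (h ∘ endpoints G) ≡ σ² (λ i j → ι (ascAdj G i j) * h (i , j))
σ-edges G h = begin
  σ (h ∘ endpoints G)
    ≡⟨ σ-lookup (edges G) h ⟩
  sum (map h (edges G))
    ≡⟨ sum-map-concatMap row h (allFin (n G)) ⟩
  sum (map (λ i → sum (map h (row i))) (allFin (n G)))
    ≡⟨ cong sum (map-cong row-sum (allFin (n G))) ⟩
  sum (map (λ i → σ (λ j → ι (ascAdj G i j) * h (i , j))) (allFin (n G)))
    ≡⟨ sum-map-tabulate {n = n G} id (λ i → σ (λ j → ι (ascAdj G i j) * h (i , j))) ⟩
  σ² (λ i j → ι (ascAdj G i j) * h (i , j)) ∎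
  where
  row : Fin (n G) → List (Fin (n G) × Fin (n G))
  row i = map (i ,_) (filterᵇ (ascAdj G i) (allFin (n G)))
  row-sum : ∀ i → sum (map h (row i)) ≡ σ (λ j → ι (ascAdj G i j) * h (i , j))
  row-sum i = trans (cong sum (sym (map-∘ (filterᵇ (ascAdj G i) (allFin (n G))))))
                (trans (sum-map-filterᵇ (ascAdj G i) (λ j → h (i , j)) (allFin (n G)))
                       (sum-map-tabulate {n = n G} id (λ j → ι (ascAdj G i j) * h (i , j))))

incident : ∀ {k} → Fin k → Fin k × Fin k → Bool
incident u (a , b) = (u == a) ∨ (u == b)

ι-incident : ∀ {k} (u : Fin k) {a b : Fin k} → a ≢ b → ι (incident u (a , b)) ≡ ι (u == a) + ι (u == b)
ι-incident u {a} {b} a≢b with u ≟ a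
... | yes refl = cong (λ c → 1 + ι c) (sym (==-≢ a≢b))
... | no _     = refl

σ-incident : ∀ {k} {a b : Fin k} → a ≢ b → σ (λ u → ι (incident u (a , b))) ≡ 2
σ-incident {a = a} {b} a≢b =
  trans (σ-cong (λ u → ι-incident u a≢b))
        (trans (σ-distrib-+ (λ u → ι (u == a)) (λ u → ι (u == b))) (cong₂ _+_ (σ-δ-count a) (σ-δ-count b)))

σ-incident-endpoints : (G : SimpleGraph) (u : Fin (n G)) → σ (λ e → ι (incident u (endpoints G e))) ≡ deg G u
σ-incident-endpoints G u = begin
  σ (λ e → ι (incident u (endpoints G e)))
    ≡⟨ σ-edges G (ι ∘ incident u) ⟩
  σ² (λ i j → ι (ascAdj G i j) * ι (incident u (i , j)))
    ≡⟨ σ²-cong split ⟩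
  σ² (λ i j → ι (u == i) * ι (ascAdj G i j) + ι (u == j) * ι (ascAdj G i j))
    ≡⟨ σ²-distrib-+ (λ i j → ι (u == i) * ι (ascAdj G i j)) (λ i j → ι (u == j) * ι (ascAdj G i j)) ⟩
  σ² (λ i j → ι (u == i) * ι (ascAdj G i j)) + σ² (λ i j → ι (u == j) * ι (ascAdj G i j))
    ≡⟨ cong₂ _+_ (trans (σ-cong (λ i → σ-*ˡ (ι (u == i)) (λ j → ι (ascAdj G i j))))
                        (σ-δ u (λ i → σ (λ j → ι (ascAdj G i j)))))
                 (trans (σ-swap (λ i j → ι (u == j) * ι (ascAdj G i j)))
                        (trans (σ-cong (λ j → σ-*ˡ (ι (u == j)) (λ i → ι (ascAdj G i j))))
                               (σ-δ u (λ j → σ (λ i → ι (ascAdj G i j)))))) ⟩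
  σ (λ j → ι (ascAdj G u j)) + σ (λ i → ι (ascAdj G i u))
    ≡⟨ sym (σ-distrib-+ (λ j → ι (ascAdj G u j)) (λ j → ι (ascAdj G j u))) ⟩
  σ (λ j → ι (ascAdj G u j) + ι (ascAdj G j u))
    ≡⟨ σ-cong (ascAdj-+-ascAdj G u) ⟩
  deg G u ∎
  where
  split : ∀ i j → ι (ascAdj G i j) * ι (incident u (i , j))
                  ≡ ι (u == i) * ι (ascAdj G i j) + ι (u == j) * ι (ascAdj G i j)
  split i j with ascAdj G i j in asc
  ... | false rewrite *-zeroʳ (ι (u == i)) | *-zeroʳ (ι (u == j)) = refl
  ... | true  = begin
    ι (incident u (i , j)) + 0       ≡⟨ +-identityʳ _ ⟩
    ι (incident u (i , j))           ≡⟨ ι-incident u (ascAdj⇒≢ G (subst T (sym asc) _)) ⟩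
    ι (u == i) + ι (u == j)          ≡⟨ sym (cong₂ _+_ (*-identityʳ (ι (u == i))) (*-identityʳ (ι (u == j)))) ⟩
    ι (u == i) * 1 + ι (u == j) * 1 ∎

handshake : (G : SimpleGraph) → σ (deg G) ≡ 2 * ∣E∣ G
handshake G = begin
  σ (deg G)
    ≡⟨ σ-cong (λ u → sym (σ-incident-endpoints G u)) ⟩
  σ² (λ u e → ι (incident u (endpoints G e)))
    ≡⟨ σ-swap (λ u e → ι (incident u (endpoints G e))) ⟩
  σ (λ e → σ (λ u → ι (incident u (endpoints G e))))
    ≡⟨ σ-cong (λ e → σ-incident (ascAdj⇒≢ G (endpoints-ascending G e))) ⟩
  σ {∣E∣ G} (λ _ → 2)
    ≡⟨ trans (σ-const (∣E∣ G) 2) (*-comm (∣E∣ G) 2) ⟩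
  2 * ∣E∣ G ∎

degR : (G : SimpleGraph) → Fin (n G + ∣E∣ G) → ℕ
degR G = degA (RAdj G)

RAdj-join : (G : SimpleGraph) (s t : Fin (n G) ⊎ Fin (∣E∣ G)) →
  RAdj G (join (n G) (∣E∣ G) s) (join (n G) (∣E∣ G) t) ≡ RAdj' G s t
RAdj-join G s t rewrite splitAt-join (n G) (∣E∣ G) s | splitAt-join (n G) (∣E∣ G) t = refl

degR-join : (G : SimpleGraph) (s : Fin (n G) ⊎ Fin (∣E∣ G)) →
  degR G (join (n G) (∣E∣ G) s) ≡ σ (λ u → ι (RAdj' G s (inj₁ u))) + σ (λ e → ι (RAdj' G s (inj₂ e)))
degR-join G s = trans (σ-↑ (n G) _)
  (cong₂ _+_ (σ-cong (λ u → cong ι (RAdj-join G s (inj₁ u)))) (σ-cong (λ e → cong ι (RAdj-join G s (inj₂ e)))))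

degR-vertex : (G : SimpleGraph) (u : Fin (n G)) → degR G (u ↑ˡ ∣E∣ G) ≡ 2 * deg G u
degR-vertex G u = begin
  degR G (u ↑ˡ ∣E∣ G)                 ≡⟨ degR-join G (inj₁ u) ⟩
  deg G u + σ (λ e → ι (incident u (endpoints G e)))
                                      ≡⟨ cong (deg G u +_) (σ-incident-endpoints G u) ⟩
  deg G u + deg G u                   ≡⟨ cong (deg G u +_) (sym (+-identityʳ (deg G u))) ⟩
  2 * deg G u ∎

degR-edge : (G : SimpleGraph) (e : Fin (∣E∣ G)) → degR G (n G ↑ʳ e) ≡ 2
degR-edge G e = begin
  degR G (n G ↑ʳ e)                                              ≡⟨ degR-join G (inj₂ e) ⟩
  σ (λ u → ι (incident u (endpoints G e))) + σ {∣E∣ G} (λ _ → 0) ≡⟨ cong₂ _+_ incident-two (σ-zero (∣E∣ G)) ⟩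
  2 ∎
  where
  incident-two : σ (λ u → ι (incident u (endpoints G e))) ≡ 2
  incident-two = σ-incident (ascAdj⇒≢ G (endpoints-ascending G e))

isVertex-↑ˡ : (G : SimpleGraph) (u : Fin (n G)) → isVertex G (u ↑ˡ ∣E∣ G) ≡ true
isVertex-↑ˡ G u rewrite splitAt-↑ˡ (n G) u (∣E∣ G) = refl

isVertex-↑ʳ : (G : SimpleGraph) (e : Fin (∣E∣ G)) → isVertex G (n G ↑ʳ e) ≡ false
isVertex-↑ʳ G e rewrite splitAt-↑ʳ (n G) (∣E∣ G) e = refl

RAdj-irrefl : (G : SimpleGraph) (x : Fin (n G + ∣E∣ G)) → RAdj G x x ≡ false
RAdj-irrefl G x with splitAt (n G) x
... | inj₁ u = irrefl G u
... | inj₂ e = refl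

RSumAdj² : (G H : SimpleGraph) → Fin (n G + ∣E∣ G) → Fin (n H) → Fin (n G + ∣E∣ G) → Fin (n H) → Bool
RSumAdj² G H x v x' v' = (isVertex G x ∧ (x == x') ∧ adj H v v') ∨ ((v == v') ∧ RAdj G x x')

RSumAdj-combine : (G H : SimpleGraph) (x x' : Fin (n G + ∣E∣ G)) (v v' : Fin (n H)) →
  RSumAdj G H (combine x v) (combine x' v') ≡ RSumAdj² G H x v x' v'
RSumAdj-combine G H x x' v v' =
  cong₂ (λ p q → RSumAdj² G H (proj₁ p) (proj₂ p) (proj₁ q) (proj₂ q)) (remQuot-combine x v) (remQuot-combine x' v')

-- The two disjuncts of RSumAdj² never hold together, since x == x' rules out RAdj G x x'.
ι-RSumAdj² : ∀ a b c d r → (b ≡ true → r ≡ false) →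
  ι ((a ∧ b ∧ c) ∨ (d ∧ r)) ≡ ι b * (ι a * ι c) + ι d * ι r
ι-RSumAdj² false false c d r _  = ι-∧ d r
ι-RSumAdj² false true  c d r _  = ι-∧ d r
ι-RSumAdj² true  false c d r _  = ι-∧ d r
ι-RSumAdj² true  true  c d r b⇒¬r rewrite b⇒¬r refl with c | d
... | true  | true  = refl
... | true  | false = refl
... | false | true  = refl
... | false | false = refl

degree-RSum : (G H : SimpleGraph) (x : Fin (n G + ∣E∣ G)) (v : Fin (n H)) →
  degA (RSumAdj G H) (combine x v) ≡ ι (isVertex G x) * deg H v + degR G x
degree-RSum G H x v = begin
  σ (λ q → ι (RSumAdj G H (combine x v) q))
    ≡⟨ σ-combine (n G + ∣E∣ G) {n H} (λ q → ι (RSumAdj G H (combine x v) q)) ⟩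
  σ² {n G + ∣E∣ G} {n H} (λ x' v' → ι (RSumAdj G H (combine x v) (combine x' v')))
    ≡⟨ σ²-cong {n G + ∣E∣ G} {n H} (λ x' v' → trans (cong ι (RSumAdj-combine G H x x' v v')) (split x' v')) ⟩
  σ² (λ x' v' → ι (x == x') * (ι (isVertex G x) * ι (adj H v v')) + ι (v == v') * ι (RAdj G x x'))
    ≡⟨ σ²-distrib-+ {n G + ∣E∣ G} {n H} _ _ ⟩
  σ² (λ x' v' → ι (x == x') * (ι (isVertex G x) * ι (adj H v v')))
    + σ² (λ x' v' → ι (v == v') * ι (RAdj G x x'))
    ≡⟨ cong₂ _+_ (trans (σ-cong (λ x' → σ-*ˡ (ι (x == x')) (λ v' → ι (isVertex G x) * ι (adj H v v'))))
                        (σ-δ x (λ _ → σ (λ v' → ι (isVertex G x) * ι (adj H v v')))))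
                 (σ-cong (λ x' → σ-δ v (λ _ → ι (RAdj G x x')))) ⟩
  σ (λ v' → ι (isVertex G x) * ι (adj H v v')) + degR G x
    ≡⟨ cong (_+ degR G x) (σ-*ˡ (ι (isVertex G x)) (λ v' → ι (adj H v v'))) ⟩
  ι (isVertex G x) * deg H v + degR G x ∎
  where
  split : ∀ x' v' → ι (RSumAdj² G H x v x' v')
                    ≡ ι (x == x') * (ι (isVertex G x) * ι (adj H v v')) + ι (v == v') * ι (RAdj G x x')
  split x' v' = ι-RSumAdj² (isVertex G x) (x == x') (adj H v v') (v == v') (RAdj G x x')
    (λ x=x' → subst (λ y → RAdj G x y ≡ false) (==⇒≡ x=x') (RAdj-irrefl G x))

degree-RSum-vertex : (G H : SimpleGraph) (u : Fin (n G)) (v : Fin (n H)) →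
  degA (RSumAdj G H) (combine (u ↑ˡ ∣E∣ G) v) ≡ 2 * deg G u + deg H v
degree-RSum-vertex G H u v = begin
  degA (RSumAdj G H) (combine (u ↑ˡ ∣E∣ G) v)
    ≡⟨ degree-RSum G H (u ↑ˡ ∣E∣ G) v ⟩
  ι (isVertex G (u ↑ˡ ∣E∣ G)) * deg H v + degR G (u ↑ˡ ∣E∣ G)
    ≡⟨ cong₂ _+_ (cong (λ b → ι b * deg H v) (isVertex-↑ˡ G u)) (degR-vertex G u) ⟩
  1 * deg H v + 2 * deg G u
    ≡⟨ trans (cong (_+ 2 * deg G u) (+-identityʳ (deg H v))) (+-comm (deg H v) _) ⟩
  2 * deg G u + deg H v ∎

degree-RSum-edge : (G H : SimpleGraph) (e : Fin (∣E∣ G)) (v : Fin (n H)) →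
  degA (RSumAdj G H) (combine (n G ↑ʳ e) v) ≡ 2
degree-RSum-edge G H e v = trans (degree-RSum G H (n G ↑ʳ e) v)
  (cong₂ _+_ (cong (λ b → ι b * deg H v) (isVertex-↑ʳ G e)) (degR-edge G e))

σ²-vertex-cubes : (G H : SimpleGraph) →
  σ² (λ u v → (2 * deg G u + deg H v) ^ 3)
    ≡ n H * (8 * F G) + 3 * (4 * M₁ G) * (2 * ∣E∣ H) + 3 * (2 * (2 * ∣E∣ G)) * M₁ H + n G * F H
σ²-vertex-cubes G H = trans (σ²-cube-+ (λ u → 2 * deg G u) (deg H))
  (cong₂ _+_ (cong₂ _+_ (cong₂ _+_ (cong (n H *_) cubes) (cong₂ (λ a b → 3 * a * b) squares (handshake H)))
                        (cong (λ a → 3 * a * M₁ H) (trans (σ-*ˡ 2 (deg G)) (cong (2 *_) (handshake G)))))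
             refl)
  where
  double-cube : ∀ a → (2 * a) ^ 3 ≡ 8 * a ^ 3
  double-cube = solve 1 (λ a → (con 2 :* a) :^ 3 := con 8 :* a :^ 3) refl
    where open +-*-Solver
  double-square : ∀ a → (2 * a) ^ 2 ≡ 4 * a ^ 2
  double-square = solve 1 (λ a → (con 2 :* a) :^ 2 := con 4 :* a :^ 2) refl
    where open +-*-Solver
  cubes : σ (λ u → (2 * deg G u) ^ 3) ≡ 8 * F G
  cubes = trans (σ-cong (λ u → double-cube (deg G u))) (σ-*ˡ 8 (λ u → deg G u ^ 3))
  squares : σ (λ u → (2 * deg G u) ^ 2) ≡ 4 * M₁ G
  squares = trans (σ-cong (λ u → double-square (deg G u))) (σ-*ˡ 4 (λ u → deg G u ^ 2))

-- The formula holds for all graphs G and H.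
theorem3 : (G H : SimpleGraph) → Connected G → 2 ≤ ∣V∣ G → Connected H →
    FRSum G H ≡ 8 * ∣V∣ H * F G + ∣V∣ G * F H + 24 * ∣E∣ H * M₁ G
    + 12 * ∣E∣ G * M₁ H + 8 * ∣V∣ H * ∣E∣ G
theorem3 G H _ _ _ = begin
  FRSum G H
    ≡⟨ σ-combine (n G + ∣E∣ G) _ ⟩
  σ² (λ x v → D x v ^ 3)
    ≡⟨ σ-↑ (n G) _ ⟩
  σ² (λ u v → D (u ↑ˡ ∣E∣ G) v ^ 3) + σ² (λ e v → D (n G ↑ʳ e) v ^ 3)
    ≡⟨ cong₂ _+_ (σ²-cong (λ u v → cong (_^ 3) (degree-RSum-vertex G H u v)))
                 (σ²-cong (λ e v → cong (_^ 3) (degree-RSum-edge G H e v))) ⟩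
  σ² (λ u v → (2 * deg G u + deg H v) ^ 3) + σ² {∣E∣ G} {n H} (λ _ _ → 8)
    ≡⟨ cong₂ _+_ (σ²-vertex-cubes G H)
                 (trans (σ-cong {∣E∣ G} (λ _ → σ-const (n H) 8)) (σ-const (∣E∣ G) (n H * 8))) ⟩
  n H * (8 * F G) + 3 * (4 * M₁ G) * (2 * ∣E∣ H) + 3 * (2 * (2 * ∣E∣ G)) * M₁ H + n G * F H
    + ∣E∣ G * (n H * 8)
    ≡⟨ collect (n G) (n H) (∣E∣ G) (∣E∣ H) (F G) (F H) (M₁ G) (M₁ H) ⟩
  8 * ∣V∣ H * F G + ∣V∣ G * F H + 24 * ∣E∣ H * M₁ G + 12 * ∣E∣ G * M₁ H + 8 * ∣V∣ H * ∣E∣ G ∎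
  where
  D : Fin (n G + ∣E∣ G) → Fin (n H) → ℕ
  D x v = degA (RSumAdj G H) (combine x v)
  collect : ∀ nG nH eG eH FG FH MG MH →
    nH * (8 * FG) + 3 * (4 * MG) * (2 * eH) + 3 * (2 * (2 * eG)) * MH + nG * FH + eG * (nH * 8)
      ≡ 8 * nH * FG + nG * FH + 24 * eH * MG + 12 * eG * MH + 8 * nH * eG
  collect = solve-∀
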